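{- Let $f\in\mathbb{Z}[x]$ be a primitive polynomial of degree $k$, and let $d$ denote the greatest common divisor of the values $f(n)$, $n\in\mathbb{N}$. Then $d$ divides $k!$. Moreover, with $D=d\prod_{p\le k}p$ (product over primes), there is an integer $a$ such that $F(n)=f(a+nD)/d$ is a polynomial with integer coefficients and $F(n)$ is coprime to $\prod_{p\le k}p$ for all $n$. Finally, $\mathcal{G}(f)$ divides $\phi(d)\,\mathcal{G}(F)$.
   Context: A polynomial in $\mathbb{Z}[x]$ is primitive if the gcd of its coefficients is $1$. $\phi$ is Euler's totient function, and for $g\in\mathbb{Z}[x]$, $\mathcal{G}(g)=\gcd\{\phi(g(n)) : n\in\mathbb{N}\}$, where $\mathbb{N}=\{1,2,3,\dots\}$. -}

module Defs where

open import Data.Nat using (ℕ; zero; suc; _*_)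
open import Data.Nat.Divisibility using (_∣_)
open import Data.Nat.ListAction using (product)
open import Data.Nat.GCD using (gcd)
open import Data.Nat.Primality using (prime?)
open import Data.Integer as ℤ using (ℤ; +_; ∣_∣)
open import Data.List using (List; []; _∷_; _++_; [_]; length; filter; map; upTo; foldr)
open import Data.Product using (∃; _×_)
open import Relation.Binary.PropositionalEquality using (_≡_; _≢_)
import Data.Nat as ℕ

-- Polynomials in ℤ[x] as coefficient lists, constant term first.
Poly : Set
Poly = List ℤ

eval : Poly → ℤ → ℤ
eval []       x = + 0
eval (c ∷ cs) x = c ℤ.+ x ℤ.* eval cs x

Primitive : Poly → Set
Primitive f = foldr gcd 0 (map ∣_∣ f) ≡ 1

HasDegree : Poly → ℕ → Set
HasDegree f k = ∃ λ cs → ∃ λ c → f ≡ cs ++ [ c ] × c ≢ + 0 × length cs ≡ k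

-- Euler's totient: number of m ∈ {1,…,n} with gcd(m,n) = 1 (so φ 0 = 0).
φ : ℕ → ℕ
φ n = length (filter (λ m → gcd m n ℕ.≟ 1) (map suc (upTo n)))

primorial : ℕ → ℕ
primorial k = product (filter prime? (upTo (suc k)))

-- g is the gcd of the values s(n), n ∈ ℕ = {1,2,3,…}
IsGcdOf : (ℕ → ℕ) → ℕ → Set
IsGcdOf s g = (∀ n → g ∣ s (suc n)) × (∀ c → (∀ n → c ∣ s (suc n)) → c ∣ g)

Is𝒢 : Poly → ℕ → Set
Is𝒢 g G = IsGcdOf (λ n → φ ∣ eval g (+ n) ∣) G

module Submission where

-- Let f ∈ ℤ[x] be primitive of degree k and d the gcd of the values f(n), n ≥ 1.
-- (i) d ∣ k!: by induction on k, d ∣ k!·aᵢ for every coefficient aᵢ of f.  The leading coefficient c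
--     is reached through the forward difference Δf (degree k-1, leading coefficient k·c); subtracting
--     c·x(x-1)⋯(x-k+1), whose values are multiples of k!, lowers the degree.  Primitivity gives d ∣ k!.
-- (ii) For each prime p some value is not divisible by p·d, and whether p·d ∣ f(x) only depends on x
--     modulo p^(d+1), since a number divisible by d and by p^(d+1) is divisible by p·d.  The Chinese
--     remainder theorem glues these into one a ≥ 0 with p·d ∤ f(a) for all primes p ≤ k.  Expanding
--     f(a + x·M) = f(a) + x·M·R(x) with M = d·P, P = ∏_{p≤k} p, the polynomial F = f(a)/d + x·P·R has
--     d·F(n) = f(a + n·M), and F(n) ≡ f(a)/d (mod P) is coprime to P, hence to d.
-- (iii) φ is multiplicative, so 𝒢(f) divides every φ(f(a + n·M)) = φ(d)·φ(F(n)), hence φ(d)·𝒢(F).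

open import Defs
open import Data.Nat using (ℕ; NonZero)
import Data.Integer as Int

module Polynomials where

  open import Data.Nat using (ℕ; zero; suc; pred; _≤_; z≤n; s≤s)
  import Data.Nat.Properties as ℕP
  open import Data.Integer using (ℤ; +_; _+_; _*_; _-_)
  import Data.Integer.Properties as ℤP
  open import Data.Integer.Tactic.RingSolver using (solve-∀)
  open import Data.List using ([]; _∷_; map)
  open import Relation.Binary.PropositionalEquality using (_≡_; refl; sym; trans; cong; cong₂; module ≡-Reasoning)

  infixl 6 _⊕_

  _⊕_ : Poly → Poly → Poly
  []      ⊕ q       = q
  (a ∷ p) ⊕ []      = a ∷ p
  (a ∷ p) ⊕ (b ∷ q) = (a + b) ∷ (p ⊕ q)

  scale : ℤ → Poly → Poly
  scale c p = map (c *_) p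

  shift : Poly → Poly
  shift []      = []
  shift (a ∷ p) = + 0 ∷ a ∷ p

  coef : Poly → ℕ → ℤ
  coef []      i       = + 0
  coef (a ∷ p) zero    = a
  coef (a ∷ p) (suc i) = coef p i

  eval-⊕ : ∀ p q x → eval (p ⊕ q) x ≡ eval p x + eval q x
  eval-⊕ []      q       x = sym (ℤP.+-identityˡ _)
  eval-⊕ (a ∷ p) []      x = sym (ℤP.+-identityʳ _)
  eval-⊕ (a ∷ p) (b ∷ q) x =
    trans (cong (λ s → (a + b) + x * s) (eval-⊕ p q x)) (ring a b x (eval p x) (eval q x))
    where
    ring : ∀ a b x P Q → (a + b) + x * (P + Q) ≡ (a + x * P) + (b + x * Q)
    ring = solve-∀

  eval-scale : ∀ c p x → eval (scale c p) x ≡ c * eval p x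
  eval-scale c []      x = sym (ℤP.*-zeroʳ c)
  eval-scale c (a ∷ p) x =
    trans (cong (λ s → c * a + x * s) (eval-scale c p x)) (ring c a x (eval p x))
    where
    ring : ∀ c a x P → c * a + x * (c * P) ≡ c * (a + x * P)
    ring = solve-∀

  eval-shift : ∀ p x → eval (shift p) x ≡ x * eval p x
  eval-shift []      x = sym (ℤP.*-zeroʳ x)
  eval-shift (a ∷ p) x = ℤP.+-identityˡ _

  coef-⊕ : ∀ p q i → coef (p ⊕ q) i ≡ coef p i + coef q i
  coef-⊕ []      q       i       = sym (ℤP.+-identityˡ _)
  coef-⊕ (a ∷ p) []      zero    = sym (ℤP.+-identityʳ _)
  coef-⊕ (a ∷ p) []      (suc i) = sym (ℤP.+-identityʳ _)
  coef-⊕ (a ∷ p) (b ∷ q) zero    = refl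
  coef-⊕ (a ∷ p) (b ∷ q) (suc i) = coef-⊕ p q i

  coef-scale : ∀ c p i → coef (scale c p) i ≡ c * coef p i
  coef-scale c []      i       = sym (ℤP.*-zeroʳ c)
  coef-scale c (a ∷ p) zero    = refl
  coef-scale c (a ∷ p) (suc i) = coef-scale c p i

  coef-shift-zero : ∀ p → coef (shift p) 0 ≡ + 0
  coef-shift-zero []      = refl
  coef-shift-zero (a ∷ p) = refl

  coef-shift-suc : ∀ p i → coef (shift p) (suc i) ≡ coef p i
  coef-shift-suc []      i = refl
  coef-shift-suc (a ∷ p) i = refl

  DegreeBelow : Poly → ℕ → Set
  DegreeBelow p n = ∀ i → n ≤ i → coef p i ≡ + 0

  degreeBelow-weaken : ∀ {p m n} → m ≤ n → DegreeBelow p m → DegreeBelow p n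
  degreeBelow-weaken m≤n h i n≤i = h i (ℕP.≤-trans m≤n n≤i)

  degreeBelow-tail : ∀ {a p n} → DegreeBelow (a ∷ p) (suc n) → DegreeBelow p n
  degreeBelow-tail h i n≤i = h (suc i) (s≤s n≤i)

  -- The forward difference (Δf)(x) = f(x+1) - f(x); for f = c + x·g it is
  -- Δ f = g + Δg + x·Δg, which is how it is computed.
  Δ : Poly → Poly
  Δ []      = []
  Δ (c ∷ g) = g ⊕ (Δ g ⊕ shift (Δ g))

  eval-Δ : ∀ f x → eval (Δ f) x ≡ eval f (x + + 1) - eval f x
  eval-Δ []      x = refl
  eval-Δ (c ∷ g) x = begin
    eval (g ⊕ (Δ g ⊕ shift (Δ g))) x
      ≡⟨ eval-⊕ g _ x ⟩
    G + eval (Δ g ⊕ shift (Δ g)) x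
      ≡⟨ cong (_+_ G) (eval-⊕ (Δ g) (shift (Δ g)) x) ⟩
    G + (eval (Δ g) x + eval (shift (Δ g)) x)
      ≡⟨ cong (λ s → G + (eval (Δ g) x + s)) (eval-shift (Δ g) x) ⟩
    G + (eval (Δ g) x + x * eval (Δ g) x)
      ≡⟨ cong (λ s → G + (s + x * s)) (eval-Δ g x) ⟩
    G + ((G₁ - G) + x * (G₁ - G))
      ≡⟨ ring c x G G₁ ⟩
    (c + (x + + 1) * G₁) - (c + x * G) ∎
    where
    open ≡-Reasoning
    G G₁ : ℤ
    G  = eval g x
    G₁ = eval g (x + + 1)
    ring : ∀ c x G G₁ → G + ((G₁ - G) + x * (G₁ - G)) ≡ (c + (x + + 1) * G₁) - (c + x * G)
    ring = solve-∀

  coef-Δ-zero : ∀ c g → coef (Δ (c ∷ g)) 0 ≡ coef g 0 + coef (Δ g) 0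
  coef-Δ-zero c g = begin
    coef (g ⊕ (Δ g ⊕ shift (Δ g))) 0
      ≡⟨ coef-⊕ g _ 0 ⟩
    coef g 0 + coef (Δ g ⊕ shift (Δ g)) 0
      ≡⟨ cong (_+_ (coef g 0)) (coef-⊕ (Δ g) (shift (Δ g)) 0) ⟩
    coef g 0 + (coef (Δ g) 0 + coef (shift (Δ g)) 0)
      ≡⟨ cong (λ s → coef g 0 + (coef (Δ g) 0 + s)) (coef-shift-zero (Δ g)) ⟩
    coef g 0 + (coef (Δ g) 0 + + 0)
      ≡⟨ cong (_+_ (coef g 0)) (ℤP.+-identityʳ _) ⟩
    coef g 0 + coef (Δ g) 0 ∎
    where open ≡-Reasoning

  coef-Δ-suc : ∀ c g i → coef (Δ (c ∷ g)) (suc i) ≡ coef g (suc i) + (coef (Δ g) (suc i) + coef (Δ g) i)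
  coef-Δ-suc c g i = begin
    coef (g ⊕ (Δ g ⊕ shift (Δ g))) (suc i)
      ≡⟨ coef-⊕ g _ (suc i) ⟩
    coef g (suc i) + coef (Δ g ⊕ shift (Δ g)) (suc i)
      ≡⟨ cong (_+_ (coef g (suc i))) (coef-⊕ (Δ g) (shift (Δ g)) (suc i)) ⟩
    coef g (suc i) + (coef (Δ g) (suc i) + coef (shift (Δ g)) (suc i))
      ≡⟨ cong (λ s → coef g (suc i) + (coef (Δ g) (suc i) + s)) (coef-shift-suc (Δ g) i) ⟩
    coef g (suc i) + (coef (Δ g) (suc i) + coef (Δ g) i) ∎
    where open ≡-Reasoning

  Δ-lowers-degree : ∀ f n → DegreeBelow f (suc n) → DegreeBelow (Δ f) n
  Δ-lowers-degree []      n h i _ = refl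
  Δ-lowers-degree (c ∷ g) n h = below
    where
    hg : DegreeBelow g n
    hg = degreeBelow-tail h
    hΔg : DegreeBelow (Δ g) (pred n)
    hΔg = Δ-lowers-degree g (pred n) (degreeBelow-weaken {g} (n≤1+pred n) hg)
      where
      n≤1+pred : ∀ n → n ≤ suc (pred n)
      n≤1+pred zero    = z≤n
      n≤1+pred (suc n) = ℕP.≤-refl
    below : DegreeBelow (Δ (c ∷ g)) n
    below zero    n≤0   = trans (coef-Δ-zero c g) (cong₂ _+_ (hg 0 n≤0) (hΔg 0 (ℕP.pred-mono-≤ n≤0)))
    below (suc i) n≤1+i = trans (coef-Δ-suc c g i) (cong₂ _+_ (hg (suc i) n≤1+i)
      (cong₂ _+_ (hΔg (suc i) (ℕP.≤⇒pred≤ n≤1+i)) (hΔg i (ℕP.pred-mono-≤ n≤1+i))))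

  Δ-leading : ∀ f n → DegreeBelow f (suc (suc n)) → coef (Δ f) n ≡ + suc n * coef f (suc n)
  Δ-leading []      n       h = sym (ℤP.*-zeroʳ (+ suc n))
  Δ-leading (c ∷ g) zero    h = begin
    coef (Δ (c ∷ g)) 0           ≡⟨ coef-Δ-zero c g ⟩
    coef g 0 + coef (Δ g) 0      ≡⟨ cong (_+_ (coef g 0)) (Δ-lowers-degree g 0 (degreeBelow-tail h) 0 z≤n) ⟩
    coef g 0 + + 0               ≡⟨ ℤP.+-identityʳ _ ⟩
    coef g 0                     ≡⟨ sym (ℤP.*-identityˡ _) ⟩
    + 1 * coef g 0               ∎
    where open ≡-Reasoning
  Δ-leading (c ∷ g) (suc n) h = begin
    coef (Δ (c ∷ g)) (suc n)
      ≡⟨ coef-Δ-suc c g n ⟩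
    coef g (suc n) + (coef (Δ g) (suc n) + coef (Δ g) n)
      ≡⟨ cong (λ s → coef g (suc n) + (s + coef (Δ g) n)) (Δ-lowers-degree g (suc n) hg (suc n) ℕP.≤-refl) ⟩
    coef g (suc n) + (+ 0 + coef (Δ g) n)
      ≡⟨ cong (λ s → coef g (suc n) + (+ 0 + s)) (Δ-leading g n hg) ⟩
    coef g (suc n) + (+ 0 + + suc n * coef g (suc n))
      ≡⟨ ring (coef g (suc n)) (+ n) ⟩
    + suc (suc n) * coef g (suc n) ∎
    where
    open ≡-Reasoning
    hg : DegreeBelow g (suc (suc n))
    hg = degreeBelow-tail h
    ring : ∀ C N → C + (+ 0 + (+ 1 + N) * C) ≡ (+ 1 + (+ 1 + N)) * C
    ring = solve-∀

module FixedDivisor where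

  open Polynomials
  open import Data.Nat as ℕ using (ℕ; zero; suc; _!; _≤_; z≤n; s≤s)
  import Data.Nat.Properties as ℕP
  import Data.Nat.Divisibility as ℕ∣
  open import Data.Nat.GCD using (gcd; gcd-greatest; c*gcd[m,n]≡gcd[cm,cn])
  open import Data.Integer using (ℤ; +_; -_; ∣_∣; _+_; _*_; _-_)
  import Data.Integer.Properties as ℤP
  open import Data.Integer.Divisibility.Signed
    using (_∣_; divides; ∣-refl; ∣ᵤ⇒∣; ∣⇒∣ᵤ; ∣m∣n⇒∣m+n; ∣m∣n⇒∣m-n; ∣m⇒∣-m; ∣n⇒∣m*n; ∣m⇒∣m*n; *-monoʳ-∣)
  open import Data.Integer.Tactic.RingSolver using (solve-∀)
  open import Data.List using ([]; _∷_; [_]; _++_; length; map; foldr)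
  import Data.List.Properties as ListP
  open import Data.Product using (_×_; _,_; proj₁; proj₂)
  open import Relation.Nullary using (yes; no)
  open import Relation.Binary.PropositionalEquality using (_≡_; refl; sym; trans; cong; cong₂; subst; module ≡-Reasoning)

  ValuesDivisible : ℕ → Poly → Set
  ValuesDivisible d f = ∀ n → + d ∣ eval f (+ suc n)

  +n+1≡+[1+n] : ∀ n → + n + + 1 ≡ + suc n
  +n+1≡+[1+n] n = cong +_ (ℕP.+-comm n 1)

  Δ-valuesDivisible : ∀ {d} f → ValuesDivisible d f → ValuesDivisible d (Δ f)
  Δ-valuesDivisible f v n = subst (+ _ ∣_)
    (sym (trans (eval-Δ f (+ suc n)) (cong (λ y → eval f y - eval f (+ suc n)) (+n+1≡+[1+n] (suc n)))))
    (∣m∣n⇒∣m-n (v (suc n)) (v n))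

  eval-degreeBelow-0 : ∀ p → DegreeBelow p 0 → ∀ x → eval p x ≡ + 0
  eval-degreeBelow-0 []      h x = refl
  eval-degreeBelow-0 (c ∷ p) h x =
    trans (cong₂ (λ a s → a + x * s) (h 0 z≤n) (eval-degreeBelow-0 p (λ i _ → h (suc i) z≤n) x))
          (cong (_+_ (+ 0)) (ℤP.*-zeroʳ x))

  eval-degreeBelow-1 : ∀ p → DegreeBelow p 1 → ∀ x → eval p x ≡ coef p 0
  eval-degreeBelow-1 []      h x = refl
  eval-degreeBelow-1 (c ∷ p) h x = begin
    c + x * eval p x ≡⟨ cong (λ s → c + x * s) (eval-degreeBelow-0 p (degreeBelow-tail h) x) ⟩
    c + x * + 0      ≡⟨ cong (_+_ c) (ℤP.*-zeroʳ x) ⟩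
    c + + 0          ≡⟨ ℤP.+-identityʳ c ⟩
    c                ∎
    where open ≡-Reasoning

  falling : ℕ → ℤ → ℤ
  falling zero    x = + 1
  falling (suc k) x = (x - + k) * falling k x

  fallingPoly : ℕ → Poly
  fallingPoly zero    = [ + 1 ]
  fallingPoly (suc k) = shift (fallingPoly k) ⊕ scale (- + k) (fallingPoly k)

  eval-fallingPoly : ∀ k x → eval (fallingPoly k) x ≡ falling k x
  eval-fallingPoly zero    x = cong (_+_ (+ 1)) (ℤP.*-zeroʳ x)
  eval-fallingPoly (suc k) x = begin
    eval (shift P ⊕ scale (- + k) P) x        ≡⟨ eval-⊕ (shift P) _ x ⟩
    eval (shift P) x + eval (scale (- + k) P) x ≡⟨ cong₂ _+_ (eval-shift P x) (eval-scale (- + k) P x) ⟩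
    x * eval P x + (- + k) * eval P x         ≡⟨ cong (λ s → x * s + (- + k) * s) (eval-fallingPoly k x) ⟩
    x * falling k x + (- + k) * falling k x   ≡⟨ ring x (+ k) (falling k x) ⟩
    (x - + k) * falling k x                   ∎
    where
    open ≡-Reasoning
    P : Poly
    P = fallingPoly k
    ring : ∀ x K F → x * F + (- K) * F ≡ (x - K) * F
    ring = solve-∀

  fallingPoly-monic : ∀ k → DegreeBelow (fallingPoly k) (suc k) × coef (fallingPoly k) k ≡ + 1
  fallingPoly-monic zero    = (λ { (suc i) _ → refl }) , refl
  fallingPoly-monic (suc k) = below , leading
    where
    P : Poly
    P = fallingPoly k
    hP : DegreeBelow P (suc k) × coef P k ≡ + 1
    hP = fallingPoly-monic k
    coef-step : ∀ i → coef (fallingPoly (suc k)) (suc i) ≡ coef P i + (- + k) * coef P (suc i)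
    coef-step i = trans (coef-⊕ (shift P) _ (suc i))
      (cong₂ _+_ (coef-shift-suc P i) (coef-scale (- + k) P (suc i)))
    below : DegreeBelow (fallingPoly (suc k)) (suc (suc k))
    below (suc i) (s≤s k<i) = trans (coef-step i) (trans
      (cong₂ (λ a b → a + (- + k) * b) (proj₁ hP i k<i) (proj₁ hP (suc i) (ℕP.m≤n⇒m≤1+n k<i)))
      (cong (_+_ (+ 0)) (ℤP.*-zeroʳ (- + k))))
    leading : coef (fallingPoly (suc k)) (suc k) ≡ + 1
    leading = trans (coef-step k) (trans
      (cong₂ (λ a b → a + (- + k) * b) (proj₂ hP) (proj₁ hP (suc k) ℕP.≤-refl))
      (cong (_+_ (+ 1)) (ℤP.*-zeroʳ (- + k))))

  falling-difference : ∀ k x → falling (suc k) (x + + 1) ≡ falling (suc k) x + + suc k * falling k x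
  falling-difference k x = begin
    falling (suc k) (x + + 1)                ≡⟨ shifted k ⟩
    (x + + 1) * falling k x                  ≡⟨ ring x (+ k) (falling k x) ⟩
    falling (suc k) x + + suc k * falling k x ∎
    where
    open ≡-Reasoning
    ring : ∀ x K F → (x + + 1) * F ≡ (x - K) * F + (+ 1 + K) * F
    ring = solve-∀
    shifted : ∀ k → falling (suc k) (x + + 1) ≡ (x + + 1) * falling k x
    shifted zero    = ring₀ x
      where
      ring₀ : ∀ x → (x + + 1 - + 0) * + 1 ≡ (x + + 1) * + 1
      ring₀ = solve-∀
    shifted (suc k) = trans (cong ((x + + 1 - + suc k) *_) (shifted k)) (ring₁ x (+ k) (falling k x))
      where
      ring₁ : ∀ x K F → (x + + 1 - (+ 1 + K)) * ((x + + 1) * F) ≡ (x + + 1) * ((x - K) * F)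
      ring₁ = solve-∀

  falling-at-0 : ∀ k → falling (suc k) (+ 0) ≡ + 0
  falling-at-0 zero    = refl
  falling-at-0 (suc k) = trans (cong ((+ 0 - + suc k) *_) (falling-at-0 k)) (ℤP.*-zeroʳ (+ 0 - + suc k))

  factorial∣falling : ∀ k n → + (k !) ∣ falling k (+ n)
  factorial∣falling zero    n       = ∣-refl
  factorial∣falling (suc k) zero    = subst (+ (suc k !) ∣_) (sym (falling-at-0 k)) (divides (+ 0) refl)
  factorial∣falling (suc k) (suc n) = subst (+ (suc k !) ∣_) step
    (∣m∣n⇒∣m+n (factorial∣falling (suc k) n) (subst (_∣ + suc k * falling k (+ n))
      (sym (ℤP.pos-* (suc k) (k !))) (*-monoʳ-∣ (+ suc k) (factorial∣falling k n))))
    where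
    step : falling (suc k) (+ n) + + suc k * falling k (+ n) ≡ falling (suc k) (+ suc n)
    step = trans (sym (falling-difference k (+ n))) (cong (falling (suc k)) (+n+1≡+[1+n] n))

  FactorialBound : ℕ → Set
  FactorialBound k = ∀ d f → DegreeBelow f (suc k) → ValuesDivisible d f → ∀ i → + d ∣ + (k !) * coef f i

  factorialBound-0 : FactorialBound 0
  factorialBound-0 d f h v zero    =
    subst (+ d ∣_) (trans (eval-degreeBelow-1 f h (+ 1)) (sym (ℤP.*-identityˡ _))) (v 0)
  factorialBound-0 d f h v (suc i) =
    subst (λ a → + d ∣ + 1 * a) (sym (h (suc i) (s≤s z≤n))) (divides (+ 0) refl)

  -- Applied to Δf, the bound at degree k controls the leading coefficient at degree k+1.
  leading-divisible : ∀ {k} → FactorialBound k → ∀ d f → DegreeBelow f (suc (suc k)) →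
                      ValuesDivisible d f → + d ∣ + (suc k !) * coef f (suc k)
  leading-divisible {k} bound d f h v =
    subst (+ d ∣_) eq (bound d (Δ f) (Δ-lowers-degree f (suc k) h) (Δ-valuesDivisible f v) k)
    where
    open ≡-Reasoning
    c : ℤ
    c = coef f (suc k)
    ring : ∀ A B C → A * (B * C) ≡ B * A * C
    ring = solve-∀
    eq : + (k !) * coef (Δ f) k ≡ + (suc k !) * c
    eq = begin
      + (k !) * coef (Δ f) k   ≡⟨ cong (_*_ (+ (k !))) (Δ-leading f k h) ⟩
      + (k !) * (+ suc k * c)  ≡⟨ ring (+ (k !)) (+ suc k) c ⟩
      + suc k * + (k !) * c    ≡⟨ cong (_* c) (sym (ℤP.pos-* (suc k) (k !))) ⟩
      + (suc k !) * c          ∎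

  stripLeading : ℕ → Poly → Poly
  stripLeading k f = f ⊕ scale (- coef f (suc k)) (fallingPoly (suc k))

  coef-stripLeading : ∀ k f i →
    coef (stripLeading k f) i ≡ coef f i + (- coef f (suc k)) * coef (fallingPoly (suc k)) i
  coef-stripLeading k f i =
    trans (coef-⊕ f _ i) (cong (_+_ (coef f i)) (coef-scale (- coef f (suc k)) (fallingPoly (suc k)) i))

  stripLeading-degree : ∀ k f → DegreeBelow f (suc (suc k)) → DegreeBelow (stripLeading k f) (suc k)
  stripLeading-degree k f h i k<i with i ℕP.≟ suc k
  ... | yes refl = trans (coef-stripLeading k f (suc k))
    (trans (cong (λ a → coef f (suc k) + (- coef f (suc k)) * a) (proj₂ (fallingPoly-monic (suc k))))
           (cancel (coef f (suc k))))
    where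
    cancel : ∀ c → c + (- c) * + 1 ≡ + 0
    cancel = solve-∀
  ... | no i≢1+k = trans (coef-stripLeading k f i)
    (trans (cong₂ (λ a b → a + (- coef f (suc k)) * b) (h i 1+k<i) (proj₁ (fallingPoly-monic (suc k)) i 1+k<i))
           (cong (_+_ (+ 0)) (ℤP.*-zeroʳ (- coef f (suc k)))))
    where
    1+k<i : suc (suc k) ≤ i
    1+k<i = ℕP.≤∧≢⇒< k<i (λ e → i≢1+k (sym e))

  stripLeading-values : ∀ k d f → + d ∣ + (suc k !) * coef f (suc k) → ValuesDivisible d f →
                        ValuesDivisible d (stripLeading k f)
  stripLeading-values k d f top v n = subst (+ d ∣_) (sym value)
    (∣m∣n⇒∣m+n (v n) (multiple (factorial∣falling (suc k) (suc n))))
    where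
    c x : ℤ
    c = coef f (suc k)
    x = + suc n
    value : eval (stripLeading k f) x ≡ eval f x + (- c) * falling (suc k) x
    value = trans (eval-⊕ f _ x)
      (cong (_+_ (eval f x)) (trans (eval-scale (- c) (fallingPoly (suc k)) x)
                                   (cong ((- c) *_) (eval-fallingPoly (suc k) x))))
    multiple : + (suc k !) ∣ falling (suc k) x → + d ∣ (- c) * falling (suc k) x
    multiple (divides q eq) = subst (+ d ∣_) (sym reassoc) (∣m⇒∣-m (∣n⇒∣m*n q top))
      where
      ring : ∀ q K c → (- c) * (q * K) ≡ - (q * (K * c))
      ring = solve-∀
      reassoc : (- c) * falling (suc k) x ≡ - (q * (+ (suc k !) * c))
      reassoc = trans (cong ((- c) *_) eq) (ring q (+ (suc k !)) c)

  -- Induction on k: the leading coefficient is handled by Δ, the rest by stripLeading.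
  factorialBound : ∀ k → FactorialBound k
  factorialBound zero          = factorialBound-0
  factorialBound (suc k) d f h v i =
    subst (+ d ∣_) eq (∣m∣n⇒∣m+n (∣n⇒∣m*n (+ suc k) rest) (∣m⇒∣m*n (coef P i) top))
    where
    c : ℤ
    c = coef f (suc k)
    P : Poly
    P = fallingPoly (suc k)
    top : + d ∣ + (suc k !) * c
    top = leading-divisible (factorialBound k) d f h v
    rest : + d ∣ + (k !) * coef (stripLeading k f) i
    rest = factorialBound k d (stripLeading k f) (stripLeading-degree k f h) (stripLeading-values k d f top v) i
    ring : ∀ K A a c p → K * (A * (a + (- c) * p)) + K * A * c * p ≡ K * A * a
    ring = solve-∀
    eq : + suc k * (+ (k !) * coef (stripLeading k f) i) + + (suc k !) * c * coef P i ≡ + (suc k !) * coef f i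
    eq = begin
      + suc k * (+ (k !) * coef (stripLeading k f) i) + + (suc k !) * c * coef P i
        ≡⟨ cong₂ (λ a K → + suc k * (+ (k !) * a) + K * c * coef P i)
                 (coef-stripLeading k f i) (ℤP.pos-* (suc k) (k !)) ⟩
      + suc k * (+ (k !) * (coef f i + (- c) * coef P i)) + + suc k * + (k !) * c * coef P i
        ≡⟨ ring (+ suc k) (+ (k !)) (coef f i) c (coef P i) ⟩
      + suc k * + (k !) * coef f i
        ≡⟨ cong (_* coef f i) (sym (ℤP.pos-* (suc k) (k !))) ⟩
      + (suc k !) * coef f i ∎
      where open ≡-Reasoning

  content : Poly → ℕ
  content p = foldr gcd 0 (map ∣_∣ p)

  divides-scaled-content : ∀ d K p → (∀ i → d ℕ∣.∣ K ℕ.* ∣ coef p i ∣) → d ℕ∣.∣ K ℕ.* content p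
  divides-scaled-content d K []      h = subst (d ℕ∣.∣_) (sym (ℕP.*-zeroʳ K)) (d ℕ∣.∣0)
  divides-scaled-content d K (a ∷ p) h =
    subst (d ℕ∣.∣_) (sym (c*gcd[m,n]≡gcd[cm,cn] K ∣ a ∣ (content p)))
      (gcd-greatest (h 0) (divides-scaled-content d K p (λ i → h (suc i))))

  coef-beyond-length : ∀ p i → length p ≤ i → coef p i ≡ + 0
  coef-beyond-length []      i       _         = refl
  coef-beyond-length (a ∷ p) (suc i) (s≤s len≤i) = coef-beyond-length p i len≤i

  hasDegree⇒degreeBelow : ∀ {f k} → HasDegree f k → DegreeBelow f (suc k)
  hasDegree⇒degreeBelow {k = k} (cs , c , refl , _ , len≡k) i k<i =
    coef-beyond-length (cs ++ [ c ]) i (subst (_≤ i) (sym len) k<i)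
    where
    len : length (cs ++ [ c ]) ≡ suc k
    len = trans (ListP.length-++ cs) (trans (ℕP.+-comm (length cs) 1) (cong suc len≡k))

  fixedDivisor∣factorial : ∀ f k → Primitive f → HasDegree f k →
                           ∀ d → IsGcdOf (λ n → ∣ eval f (+ n) ∣) d → d ℕ∣.∣ k !
  fixedDivisor∣factorial f k prim hasDeg d (d∣values , _) =
    subst (d ℕ∣.∣_) (trans (cong (k ! ℕ.*_) prim) (ℕP.*-identityʳ (k !)))
      (divides-scaled-content d (k !) f each)
    where
    each : ∀ i → d ℕ∣.∣ k ! ℕ.* ∣ coef f i ∣
    each i = subst (d ℕ∣.∣_) (ℤP.abs-* (+ (k !)) (coef f i))
      (∣⇒∣ᵤ (factorialBound k d f (hasDegree⇒degreeBelow hasDeg) (λ n → ∣ᵤ⇒∣ (d∣values n)) i))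

module NumberTheory where

  open import Data.Nat using (zero; suc; _!; _+_; _*_; _^_; _≤_; _<_; NonZero; s≤s; z≤n; nonTrivial⇒n>1; ≢-nonZero; ≢-nonZero⁻¹)
  open import Data.Nat.Properties
  open import Data.Nat.Divisibility
  open import Data.Nat.Coprimality using (Coprime; coprime-divisor)
  open import Data.Nat.Primality
  open import Data.Nat.Primality.Factorisation using (factorise; factorisationHasAllPrimeFactors)
  open import Data.Nat.ListAction using (product)
  open import Data.Nat.ListAction.Properties using (∈⇒∣product)
  open import Data.List using ([]; _∷_; filter; upTo)
  open import Data.List.Membership.Propositional using (_∈_)
  open import Data.List.Relation.Unary.All using (_∷_)
  import Data.List.Relation.Unary.All.Properties as AllP
  import Data.List.Membership.Propositional.Properties as ∈P
  open import Data.Product using (∃; _×_; _,_; proj₁)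
  open import Data.Sum using (_⊎_; inj₁; inj₂)
  open import Data.Empty using (⊥; ⊥-elim)
  open import Relation.Nullary using (yes; no)
  open import Relation.Binary.PropositionalEquality using (_≡_; _≢_; refl; sym; trans; cong; subst)

  prime>1 : ∀ {p} → Prime p → 1 < p
  prime>1 {p} pp = nonTrivial⇒n>1 p {{prime⇒nonTrivial pp}}

  prime≢1 : ∀ {p} → Prime p → p ≢ 1
  prime≢1 pp refl = <-irrefl refl (prime>1 pp)

  primeFactor : ∀ n → 1 < n → ∃ λ q → Prime q × q ∣ n
  primeFactor n@(suc _) 1<n with factorise n
  ... | record { factors = [] ; isFactorisation = n≡1 } = ⊥-elim (<-irrefl (sym n≡1) 1<n)
  ... | record { factors = q ∷ qs ; isFactorisation = eq ; factorsPrime = pq ∷ _ } =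
    q , pq , divides (product qs) (trans eq (*-comm q (product qs)))

  noCommonPrime⇒coprime : ∀ {m n} → (∀ q → Prime q → q ∣ m → q ∣ n → ⊥) → Coprime m n
  noCommonPrime⇒coprime h {zero} (0∣m , 0∣n) with 0∣⇒≡0 0∣m | 0∣⇒≡0 0∣n
  ... | refl | refl = ⊥-elim (h 2 prime[2] (2 ∣0) (2 ∣0))
  noCommonPrime⇒coprime h {1} _ = refl
  noCommonPrime⇒coprime h {suc (suc i)} (i∣m , i∣n) with primeFactor (suc (suc i)) (s≤s (s≤s z≤n))
  ... | q , pq , q∣i = ⊥-elim (h q pq (∣-trans q∣i i∣m) (∣-trans q∣i i∣n))

  prime∣prime⇒≡ : ∀ {q p} → Prime q → Prime p → q ∣ p → q ≡ p
  prime∣prime⇒≡ pq pp q∣p with prime⇒irreducible pp q∣p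
  ... | inj₁ q≡1 = ⊥-elim (prime≢1 pq q≡1)
  ... | inj₂ q≡p = q≡p

  prime∣^⇒∣ : ∀ {q} p m → Prime q → q ∣ p ^ m → q ∣ p
  prime∣^⇒∣ p zero    pq q∣1 = ⊥-elim (prime≢1 pq (∣1⇒≡1 q∣1))
  prime∣^⇒∣ p (suc m) pq q∣pᵐ⁺¹ with euclidsLemma p (p ^ m) pq q∣pᵐ⁺¹
  ... | inj₁ q∣p  = q∣p
  ... | inj₂ q∣pᵐ = prime∣^⇒∣ p m pq q∣pᵐ

  prime∣!⇒≤ : ∀ {q} j → Prime q → q ∣ j ! → q ≤ j
  prime∣!⇒≤ zero    pq q∣1 = ⊥-elim (prime≢1 pq (∣1⇒≡1 q∣1))
  prime∣!⇒≤ (suc j) pq q∣j! with euclidsLemma (suc j) (j !) pq q∣j!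
  ... | inj₁ q∣1+j = ∣⇒≤ q∣1+j
  ... | inj₂ q∣j!  = m≤n⇒m≤1+n (prime∣!⇒≤ j pq q∣j!)

  ≤⇒∣! : ∀ {q j} → 1 ≤ q → q ≤ j → q ∣ j !
  ≤⇒∣! {suc q} _ q≤j = ∣-trans (m∣m*n (q !)) (m≤n⇒m!∣n! q≤j)

  prime≤⇒∣primorial : ∀ {p} k → Prime p → p ≤ k → p ∣ primorial k
  prime≤⇒∣primorial k pp p≤k = ∈⇒∣product (∈P.∈-filter⁺ prime? (∈P.∈-upTo⁺ (s≤s p≤k)) pp)

  prime∣primorial⇒≤ : ∀ {p} k → Prime p → p ∣ primorial k → p ≤ k
  prime∣primorial⇒≤ {p} k pp p∣P = ≤-pred (∈P.∈-upTo⁻ (proj₁ (∈P.∈-filter⁻ prime? member)))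
    where
    member : p ∈ filter prime? (upTo (suc k))
    member = factorisationHasAllPrimeFactors pp p∣P (AllP.all-filter prime? (upTo (suc k)))

  primorial≢0 : ∀ k → NonZero (primorial k)
  primorial≢0 k = productOfPrimes≢0 (AllP.all-filter prime? (upTo (suc k)))

  coprime-* : ∀ {x m n} → Coprime x m → Coprime x n → Coprime x (m * n)
  coprime-* {x} {m} {n} x⊥m x⊥n = noCommonPrime⇒coprime λ q pq q∣x q∣mn →
    prime≢1 pq (one-factor q∣x (euclidsLemma m n pq q∣mn))
    where
    one-factor : ∀ {q} → q ∣ x → q ∣ m ⊎ q ∣ n → q ≡ 1
    one-factor q∣x (inj₁ q∣m) = x⊥m (q∣x , q∣m)
    one-factor q∣x (inj₂ q∣n) = x⊥n (q∣x , q∣n)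

  coprime-*⁻ : ∀ {x m n} → Coprime x (m * n) → Coprime x m × Coprime x n
  coprime-*⁻ {x} {m} {n} x⊥mn =
    (λ (c∣x , c∣m) → x⊥mn (c∣x , ∣-trans c∣m (m∣m*n n))) ,
    (λ (c∣x , c∣n) → x⊥mn (c∣x , ∣-trans c∣n (n∣m*n m)))

  ^-monoˡ-∣ : ∀ {a b} n → a ∣ b → a ^ n ∣ b ^ n
  ^-monoˡ-∣ zero    a∣b = ∣-refl
  ^-monoˡ-∣ (suc n) a∣b = *-pres-∣ a∣b (^-monoˡ-∣ n a∣b)

  n<p^n : ∀ {p} n → 1 < p → n < p ^ n
  n<p^n zero    _   = s≤s z≤n
  n<p^n {p} (suc n) 1<p = begin-strict
    suc n         ≤⟨ n<p^n n 1<p ⟩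
    p ^ n         <⟨ m<m+n (p ^ n) (≤-<-trans z≤n (n<p^n n 1<p)) ⟩
    p ^ n + p ^ n ≡⟨ cong (p ^ n +_) (sym (+-identityʳ (p ^ n))) ⟩
    2 * p ^ n     ≤⟨ *-monoˡ-≤ (p ^ n) 1<p ⟩
    p * p ^ n     ∎
    where open ≤-Reasoning

  -- If d ≥ 1 and p is prime, an integer divisible by both d and p^(d+1) is divisible by p·d:
  -- writing n = t·d, either p ∣ t, or p^(d+1) is coprime to t and would divide d < p^(d+1).
  p*d∣ : ∀ {p d n} .{{_ : NonZero d}} → Prime p → d ∣ n → p ^ suc d ∣ n → p * d ∣ n
  p*d∣ {p} {d} pp (divides t n≡td) pᵈ⁺¹∣n with p ∣? t
  ... | yes (divides s t≡sp) = divides s (trans n≡td (trans (cong (_* d) t≡sp) (*-assoc s p d)))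
  ... | no p∤t = ⊥-elim (<-irrefl refl (≤-<-trans (∣⇒≤ pᵈ⁺¹∣d) d<pᵈ⁺¹))
    where
    pᵈ⁺¹⊥t : Coprime (p ^ suc d) t
    pᵈ⁺¹⊥t = noCommonPrime⇒coprime λ q pq q∣pᵈ⁺¹ q∣t →
      p∤t (subst (_∣ t) (prime∣prime⇒≡ pq pp (prime∣^⇒∣ p (suc d) pq q∣pᵈ⁺¹)) q∣t)
    pᵈ⁺¹∣d : p ^ suc d ∣ d
    pᵈ⁺¹∣d = coprime-divisor pᵈ⁺¹⊥t (subst (p ^ suc d ∣_) n≡td pᵈ⁺¹∣n)
    d<pᵈ⁺¹ : d < p ^ suc d
    d<pᵈ⁺¹ = <-≤-trans (n<p^n d (prime>1 pp)) (m≤n*m (p ^ d) p {{prime⇒nonZero pp}})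

  ∣!-coprime : ∀ {d c} k → d ∣ k ! → Coprime c (primorial k) → Coprime d c
  ∣!-coprime k d∣k! c⊥P = noCommonPrime⇒coprime λ q pq q∣d q∣c →
    prime≢1 pq (c⊥P (q∣c , prime≤⇒∣primorial k pq (prime∣!⇒≤ k pq (∣-trans q∣d d∣k!))))

  divisor-nonZero : ∀ {m n} .{{_ : NonZero n}} → m ∣ n → NonZero m
  divisor-nonZero {n = n} m∣n = ≢-nonZero λ { refl → ≢-nonZero⁻¹ n (0∣⇒≡0 m∣n) }

module Congruences where

  open Polynomials
  open import Data.Nat as ℕ using (ℕ; suc; pred; NonZero)
  import Data.Nat.Properties as ℕP
  open import Data.Nat.Coprimality using (Coprime; coprime-Bézout)
  open import Data.Nat.GCD using (module Bézout)
  open import Data.Integer using (ℤ; +_; -_; _+_; _*_; _-_; _%ℕ_; _/ℕ_)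
  import Data.Integer.Properties as ℤP
  open import Data.Integer.DivMod using (a≡a%ℕn+[a/ℕn]*n)
  open import Data.Integer.Divisibility.Signed using (_∣_; divides; ∣-refl; ∣-trans; ∣m∣n⇒∣m+n)
  open import Data.Integer.Tactic.RingSolver using (solve-∀)
  open import Data.List using ([]; _∷_)
  open import Data.Product using (∃; _×_; _,_)
  open import Relation.Binary.PropositionalEquality using (_≡_; refl; sym; trans; cong; cong₂; subst; module ≡-Reasoning)
  open ≡-Reasoning

  eval-difference : ∀ f x y → (x - y) ∣ (eval f x - eval f y)
  eval-difference []      x y = divides (+ 0) refl
  eval-difference (c ∷ g) x y with eval-difference g x y
  ... | divides q g[x]-g[y]≡q[x-y] = divides (x * q + eval g y) (begin
    (c + x * G) - (c + y * H)     ≡⟨ ring₁ c x y G H ⟩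
    x * (G - H) + (x - y) * H     ≡⟨ cong (λ t → x * t + (x - y) * H) g[x]-g[y]≡q[x-y] ⟩
    x * (q * (x - y)) + (x - y) * H ≡⟨ ring₂ x y q H ⟩
    (x * q + H) * (x - y)         ∎)
    where
    G H : ℤ
    G = eval g x
    H = eval g y
    ring₁ : ∀ c x y G H → (c + x * G) - (c + y * H) ≡ x * (G - H) + (x - y) * H
    ring₁ = solve-∀
    ring₂ : ∀ x y q H → x * (q * (x - y)) + (x - y) * H ≡ (x * q + H) * (x - y)
    ring₂ = solve-∀

  eval-congruent : ∀ f {M} x y → M ∣ x - y → M ∣ eval f x - eval f y
  eval-congruent f x y M∣x-y = ∣-trans M∣x-y (eval-difference f x y)

  expansion : ℤ → ℤ → Poly → Poly
  expansion a M []      = []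
  expansion a M (c ∷ g) = scale a (expansion a M g) ⊕ (eval g a ∷ scale M (expansion a M g))

  eval-expansion : ∀ a M f x → eval f (a + x * M) ≡ eval f a + x * M * eval (expansion a M f) x
  eval-expansion a M []      x = sym (cong (_+_ (+ 0)) (ℤP.*-zeroʳ (x * M)))
  eval-expansion a M (c ∷ g) x = begin
    c + (a + x * M) * eval g (a + x * M)
      ≡⟨ cong (λ t → c + (a + x * M) * t) (eval-expansion a M g x) ⟩
    c + (a + x * M) * (G + x * M * R)
      ≡⟨ ring c a x M G R ⟩
    c + a * G + x * M * (a * R + (G + x * (M * R)))
      ≡⟨ cong (λ t → c + a * G + x * M * t) (sym value) ⟩
    c + a * G + x * M * eval (expansion a M (c ∷ g)) x ∎
    where
    G R : ℤ
    G = eval g a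
    R = eval (expansion a M g) x
    value : eval (expansion a M (c ∷ g)) x ≡ a * R + (G + x * (M * R))
    value = trans (eval-⊕ (scale a (expansion a M g)) _ x)
      (cong₂ (λ u v → u + (G + x * v)) (eval-scale a (expansion a M g) x) (eval-scale M (expansion a M g) x))
    ring : ∀ c a x M G R → c + (a + x * M) * (G + x * M * R) ≡ c + a * G + x * M * (a * R + (G + x * (M * R)))
    ring = solve-∀

  inverse-mod : ∀ Q P → Coprime Q P → ∃ λ s → + P ∣ s * + Q - + 1
  inverse-mod Q P Q⊥P with coprime-Bézout Q⊥P
  ... | Bézout.+- x y 1+yP≡xQ = + x , divides (+ y) (begin
    + x * + Q - + 1   ≡⟨ cong (_- + 1) (trans (sym (ℤP.pos-* x Q)) (cong +_ (sym 1+yP≡xQ))) ⟩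
    + (1 ℕ.+ y ℕ.* P) - + 1 ≡⟨ cong (_- + 1) (trans (ℤP.pos-+ 1 (y ℕ.* P)) (cong (_+_ (+ 1)) (ℤP.pos-* y P))) ⟩
    + 1 + + y * + P - + 1  ≡⟨ ring (+ y) (+ P) ⟩
    + y * + P              ∎)
    where
    ring : ∀ y P → + 1 + y * P - + 1 ≡ y * P
    ring = solve-∀
  ... | Bézout.-+ x y 1+xQ≡yP = - + x , divides (- + y) (begin
    - + x * + Q - + 1      ≡⟨ ring (+ x) (+ Q) ⟩
    - (+ 1 + + x * + Q)    ≡⟨ cong (λ t → - (+ 1 + t)) (sym (ℤP.pos-* x Q)) ⟩
    - (+ (1 ℕ.+ x ℕ.* Q))  ≡⟨ cong (λ t → - (+ t)) 1+xQ≡yP ⟩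
    - (+ (y ℕ.* P))        ≡⟨ cong -_ (ℤP.pos-* y P) ⟩
    - (+ y * + P)          ≡⟨ ℤP.neg-distribˡ-* (+ y) (+ P) ⟩
    - + y * + P            ∎)
    where
    ring : ∀ x Q → - x * Q - + 1 ≡ - (+ 1 + x * Q)
    ring = solve-∀

  crt : ∀ Q P → Coprime Q P → ∀ a b → ∃ λ x → (+ Q ∣ x - a) × (+ P ∣ x - b)
  crt Q P Q⊥P a b with inverse-mod Q P Q⊥P
  ... | s , divides t sQ-1≡tP = x , Q∣x-a , P∣x-b
    where
    x : ℤ
    x = a + + Q * (s * (b - a))
    ring₁ : ∀ a u → a + u - a ≡ u
    ring₁ = solve-∀
    Q∣x-a : + Q ∣ x - a
    Q∣x-a = divides (s * (b - a)) (trans (ring₁ a _) (ℤP.*-comm (+ Q) (s * (b - a))))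
    ring₂ : ∀ a b Q s → a + Q * (s * (b - a)) - b ≡ (s * Q - + 1) * (b - a)
    ring₂ = solve-∀
    ring₃ : ∀ t P u → t * P * u ≡ t * u * P
    ring₃ = solve-∀
    P∣x-b : + P ∣ x - b
    P∣x-b = divides (t * (b - a)) (trans (ring₂ a b (+ Q) s)
      (trans (cong (_* (b - a)) sQ-1≡tP) (ring₃ t (+ P) (b - a))))

  %ℕ-congruent : ∀ x M .{{_ : NonZero M}} → + M ∣ + (x %ℕ M) - x
  %ℕ-congruent x M = divides (- (x /ℕ M)) (begin
    + (x %ℕ M) - x                            ≡⟨ cong (_-_ (+ (x %ℕ M))) (a≡a%ℕn+[a/ℕn]*n x M) ⟩
    + (x %ℕ M) - (+ (x %ℕ M) + x /ℕ M * + M)  ≡⟨ ring (+ (x %ℕ M)) (x /ℕ M) (+ M) ⟩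
    - (x /ℕ M) * + M                          ∎)
    where
    ring : ∀ r q M → r - (r + q * M) ≡ - q * M
    ring = solve-∀

  positive-congruent : ∀ x M .{{_ : NonZero M}} → ∃ λ n → + M ∣ + suc n - x
  positive-congruent x M = r ℕ.+ pred M , subst (+ M ∣_) eq (∣m∣n⇒∣m+n (%ℕ-congruent x M) ∣-refl)
    where
    r : ℕ
    r = x %ℕ M
    ring : ∀ r x M → (r - x) + M ≡ (r + M) - x
    ring = solve-∀
    eq : (+ r - x) + + M ≡ + suc (r ℕ.+ pred M) - x
    eq = trans (ring (+ r) x (+ M)) (cong (_- x) (trans (sym (ℤP.pos-+ r M))
      (cong +_ (trans (cong (r ℕ.+_) (sym (ℕP.suc-pred M))) (ℕP.+-suc r (pred M))))))

module Construction (f : Poly) (d : ℕ) .{{_ : NonZero d}} (d-gcd : IsGcdOf (λ n → Int.∣ eval f (Int.+ n) ∣) d) where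

  open Polynomials
  open Congruences
  open NumberTheory
  open import Data.Nat as ℕ using (ℕ; zero; suc; _!; _^_; _≤_; NonZero)
  import Data.Nat.Properties as ℕP
  import Data.Nat.Divisibility as ℕ∣
  open import Data.Nat.Coprimality using (Coprime)
  open import Data.Nat.Primality using (Prime; prime?; prime⇒nonZero)
  open import Data.Nat.DivMod using (_%_; m%n<n)
  open import Data.Integer using (ℤ; +_; -_; ∣_∣; _+_; _*_; _-_; _%ℕ_)
  import Data.Integer.Properties as ℤP
  open import Data.Integer.Divisibility.Signed
    using (_∣_; divides; quotient; _∣?_; ∣ᵤ⇒∣; ∣⇒∣ᵤ; ∣-trans; ∣m∣n⇒∣m-n; ∣n⇒∣m*n; ∣m⇒∣m*n)
  open import Data.Integer.Tactic.RingSolver using (solve-∀)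
  open import Data.List using (_∷_)
  open import Data.Fin using (Fin; toℕ; fromℕ<)
  import Data.Fin.Properties as Fin
  open import Data.Product using (∃; _×_; _,_; proj₁; proj₂)
  open import Data.Sum using (inj₁; inj₂)
  open import Data.Empty using (⊥-elim)
  open import Relation.Nullary using (yes; no; ¬_)
  open import Relation.Binary.PropositionalEquality using (_≡_; refl; sym; trans; cong; cong₂; subst; module ≡-Reasoning)

  private
    cancel-difference : ∀ A B → A - (A - B) ≡ B
    cancel-difference = solve-∀

  d∣f : ∀ x → + d ∣ eval f x
  d∣f x with positive-congruent x d
  ... | n , d∣n+1-x = subst (+ d ∣_) (cancel-difference (eval f (+ suc n)) (eval f x))
    (∣m∣n⇒∣m-n (∣ᵤ⇒∣ {+ d} {eval f (+ suc n)} (proj₁ d-gcd n)) (eval-congruent f (+ suc n) x d∣n+1-x))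

  p*d∣f-congruent : ∀ {p x y} → Prime p → + (p ^ suc d) ∣ x - y → + (p ℕ.* d) ∣ eval f x → + (p ℕ.* d) ∣ eval f y
  p*d∣f-congruent {p} {x} {y} pp pᵈ⁺¹∣x-y pd∣fx =
    subst (+ (p ℕ.* d) ∣_) (cancel-difference (eval f x) (eval f y)) (∣m∣n⇒∣m-n pd∣fx pd∣fx-fy)
    where
    pd∣fx-fy : + (p ℕ.* d) ∣ eval f x - eval f y
    pd∣fx-fy = ∣ᵤ⇒∣ (p*d∣ pp (∣⇒∣ᵤ (∣m∣n⇒∣m-n (d∣f x) (d∣f y))) (∣⇒∣ᵤ (eval-congruent f x y pᵈ⁺¹∣x-y)))

  ¬p*d∣all : ∀ p → Prime p → ¬ (∀ n → + (p ℕ.* d) ∣ eval f (+ suc n))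
  ¬p*d∣all p pp pd∣all = prime≢1 pp (ℕ∣.∣1⇒≡1 (ℕ∣.*-cancelʳ-∣ d pd∣1*d))
    where
    pd∣1*d : p ℕ.* d ℕ∣.∣ 1 ℕ.* d
    pd∣1*d = subst (p ℕ.* d ℕ∣.∣_) (sym (ℕP.*-identityˡ d))
      (proj₂ d-gcd (p ℕ.* d) (λ n → ∣⇒∣ᵤ {+ (p ℕ.* d)} {eval f (+ suc n)} (pd∣all n)))

  -- Divisibility of the values by M is periodic, so it suffices to know it on the residues n < M.
  divides-residues⇒all : ∀ M .{{_ : NonZero M}} → (∀ (r : Fin M) → + M ∣ eval f (+ suc (toℕ r))) →
                         ∀ n → + M ∣ eval f (+ suc n)
  divides-residues⇒all M residues n = subst (+ M ∣_) (cancel-difference (eval f (+ suc r)) (eval f (+ suc n)))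
    (∣m∣n⇒∣m-n at-residue (eval-congruent f (+ suc r) (+ suc n) residue-congruent))
    where
    r : ℕ
    r = n % M
    at-residue : + M ∣ eval f (+ suc r)
    at-residue = subst (λ i → + M ∣ eval f (+ suc i)) (Fin.toℕ-fromℕ< (m%n<n n M)) (residues (fromℕ< (m%n<n n M)))
    ring : ∀ r n → (+ 1 + r) - (+ 1 + n) ≡ r - n
    ring = solve-∀
    residue-congruent : + M ∣ + suc r - + suc n
    residue-congruent = subst (+ M ∣_) (sym (ring (+ r) (+ n))) (%ℕ-congruent (+ n) M)

  -- For every prime p some value f(n), n ≥ 1, is not divisible by p·d; a witness is found by
  -- decidable search among the residues n < p·d.
  p*d∤f : ∀ p → Prime p → ∃ λ n → ¬ (+ (p ℕ.* d) ∣ eval f (+ suc n))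
  p*d∤f p pp = witness (Fin.¬∀⟶∃¬ M (λ r → + M ∣ eval f (+ suc (toℕ r))) (λ r → + M ∣? eval f (+ suc (toℕ r)))
                         (λ residues → ¬p*d∣all p pp (divides-residues⇒all M residues)))
    where
    M : ℕ
    M = p ℕ.* d
    instance
      M≢0 : NonZero M
      M≢0 = ℕP.m*n≢0 p d {{prime⇒nonZero pp}}
    witness : (∃ λ (r : Fin M) → ¬ (+ M ∣ eval f (+ suc (toℕ r)))) → ∃ λ n → ¬ (+ M ∣ eval f (+ suc n))
    witness (r , ¬M∣f) = toℕ r , ¬M∣f

  Good : ℕ → ℤ → Set
  Good j a = ∀ p → Prime p → p ≤ j → ¬ (+ (p ℕ.* d) ∣ eval f a)

  -- Goodness up to j only depends on a modulo (j!)^(d+1), since p^(d+1) ∣ (j!)^(d+1) for p ≤ j.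
  good-congruent : ∀ {j a b} → Good j a → + ((j !) ^ suc d) ∣ b - a → Good j b
  good-congruent {j} {a} {b} good-a M∣b-a p pp p≤j pd∣fb = good-a p pp p≤j (p*d∣f-congruent pp pᵈ⁺¹∣b-a pd∣fb)
    where
    pᵈ⁺¹∣b-a : + (p ^ suc d) ∣ b - a
    pᵈ⁺¹∣b-a = ∣-trans (∣ᵤ⇒∣ (^-monoˡ-∣ (suc d) (≤⇒∣! (ℕP.<⇒≤ (prime>1 pp)) p≤j))) M∣b-a

  good-extend : ∀ j a → Good j a → (Prime (suc j) → ¬ (+ (suc j ℕ.* d) ∣ eval f a)) → Good (suc j) a
  good-extend j a good-a new p pp p≤1+j with ℕP.m≤n⇒m<n∨m≡n p≤1+j
  ... | inj₁ p<1+j = good-a p pp (ℕP.≤-pred p<1+j)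
  ... | inj₂ refl  = new pp

  factorial⊥prime : ∀ j → Prime (suc j) → Coprime ((j !) ^ suc d) (suc j ^ suc d)
  factorial⊥prime j 1+j-prime = noCommonPrime⇒coprime λ q pq q∣Q q∣P → ℕP.<-irrefl refl (subst (_≤ j)
    (prime∣prime⇒≡ pq 1+j-prime (prime∣^⇒∣ (suc j) (suc d) pq q∣P)) (prime∣!⇒≤ j pq (prime∣^⇒∣ (j !) (suc d) pq q∣Q)))

  good-step-prime : ∀ j a → Good j a → Prime (suc j) → ∃ λ a' → Good (suc j) a'
  good-step-prime j a good-a 1+j-prime =
    a' , good-extend j a' (good-congruent good-a (proj₁ (proj₂ glued))) (λ _ → new-prime)
    where
    witness : ∃ λ n → ¬ (+ (suc j ℕ.* d) ∣ eval f (+ suc n))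
    witness = p*d∤f (suc j) 1+j-prime
    glued : ∃ λ x → (+ ((j !) ^ suc d) ∣ x - a) × (+ (suc j ^ suc d) ∣ x - + suc (proj₁ witness))
    glued = crt ((j !) ^ suc d) (suc j ^ suc d) (factorial⊥prime j 1+j-prime) a (+ suc (proj₁ witness))
    a' : ℤ
    a' = proj₁ glued
    new-prime : ¬ (+ (suc j ℕ.* d) ∣ eval f a')
    new-prime pd∣fa' = proj₂ witness (p*d∣f-congruent 1+j-prime (proj₂ (proj₂ glued)) pd∣fa')

  good-step : ∀ j a → Good j a → ∃ λ a' → Good (suc j) a'
  good-step j a good-a with prime? (suc j)
  ... | yes 1+j-prime = good-step-prime j a good-a 1+j-prime
  ... | no ¬prime = a , good-extend j a good-a (λ 1+j-prime → ⊥-elim (¬prime 1+j-prime))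

  good-from : ∀ k → ∃ λ a → Good k a
  good-from zero    = + 0 , λ p pp p≤0 → ⊥-elim (ℕP.n≮0 (ℕP.<-≤-trans (prime>1 pp) p≤0))
  good-from (suc k) with good-from k
  ... | a , good-a = good-step k a good-a

  good-exists : ∀ k → ∃ λ a → Good k (+ a)
  good-exists k with good-from k
  ... | a , good-a = a %ℕ M , good-congruent good-a (%ℕ-congruent a M)
    where
    M : ℕ
    M = (k !) ^ suc d
    instance
      M≢0 : NonZero M
      M≢0 = ℕP.m^n≢0 (k !) (suc d) {{k ℕP.!≢0}}

  -- With q = f(a)/d, the polynomial F(x) = f(a + x·d·P)/d = q + x·P·R(x), R from the expansion of f at a.
  reduced : ℕ → ℤ → Poly
  reduced P a = quotient (d∣f a) ∷ scale (+ P) (expansion a (+ (d ℕ.* P)) f)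

  eval-reduced : ∀ P a x → eval (reduced P a) x ≡ quotient (d∣f a) + x * (+ P * eval (expansion a (+ (d ℕ.* P)) f) x)
  eval-reduced P a x = cong (λ t → quotient (d∣f a) + x * t) (eval-scale (+ P) (expansion a (+ (d ℕ.* P)) f) x)

  d*reduced : ∀ P a x → + d * eval (reduced P a) x ≡ eval f (a + x * + (d ℕ.* P))
  d*reduced P a x = begin
    + d * eval (reduced P a) x              ≡⟨ cong (+ d *_) (eval-reduced P a x) ⟩
    + d * (q + x * (+ P * R))               ≡⟨ ring (+ d) q x (+ P) R ⟩
    q * + d + x * (+ d * + P) * R           ≡⟨ cong₂ (λ u v → u + x * v * R) (sym (_∣_.equality (d∣f a))) (sym (ℤP.pos-* d P)) ⟩
    eval f a + x * + (d ℕ.* P) * R          ≡⟨ sym (eval-expansion a (+ (d ℕ.* P)) f x) ⟩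
    eval f (a + x * + (d ℕ.* P))            ∎
    where
    open ≡-Reasoning
    q = quotient (d∣f a)
    R = eval (expansion a (+ (d ℕ.* P)) f) x
    ring : ∀ D q x P R → D * (q + x * (P * R)) ≡ q * D + x * (D * P) * R
    ring = solve-∀

  ∣reduced∧∣P⇒∣quotient : ∀ P a x r → + r ∣ eval (reduced P a) x → + r ∣ + P → + r ∣ quotient (d∣f a)
  ∣reduced∧∣P⇒∣quotient P a x r r∣F r∣P = subst (+ r ∣_) (trans (cong (_- x * (+ P * R)) (eval-reduced P a x)) (ring q (x * (+ P * R))))
    (∣m∣n⇒∣m-n r∣F (∣n⇒∣m*n x (∣m⇒∣m*n R r∣P)))
    where
    q = quotient (d∣f a)
    R = eval (expansion a (+ (d ℕ.* P)) f) x
    ring : ∀ q t → q + t - t ≡ q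
    ring = solve-∀

  ∣quotient⇒*d∣ : ∀ a {r} → + r ∣ quotient (d∣f a) → + (r ℕ.* d) ∣ eval f a
  ∣quotient⇒*d∣ a {r} (divides u q≡ur) = divides u (begin
    eval f a                 ≡⟨ _∣_.equality (d∣f a) ⟩
    quotient (d∣f a) * + d   ≡⟨ cong (_* + d) q≡ur ⟩
    u * + r * + d            ≡⟨ ℤP.*-assoc u (+ r) (+ d) ⟩
    u * (+ r * + d)          ≡⟨ cong (u *_) (sym (ℤP.pos-* r d)) ⟩
    u * + (r ℕ.* d)          ∎)
    where open ≡-Reasoning

  -- For a good base point every value of F is coprime to the primorial P: a prime r dividing both
  -- For a good base point every value of F is coprime to the primorial P: a prime r dividing both
  -- would give r·d ∣ f(a) with r ≤ k.
  reduced-coprime : ∀ k a → Good k a → ∀ x → Coprime ∣ eval (reduced (primorial k) a) x ∣ (primorial k)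
  reduced-coprime k a good-a x = noCommonPrime⇒coprime {∣ F ∣} {primorial k} λ r pr r∣F r∣P →
    good-a r pr (prime∣primorial⇒≤ k pr r∣P) (∣quotient⇒*d∣ a (∣reduced∧∣P⇒∣quotient (primorial k) a x r
      (∣ᵤ⇒∣ {+ r} {F} r∣F) (∣ᵤ⇒∣ {+ r} {+ primorial k} r∣P)))
    where F = eval (reduced (primorial k) a) x

module Totient where

  open NumberTheory using (coprime-*; coprime-*⁻)
  open import Data.Nat using (ℕ; zero; suc; _+_; _*_; _<_; NonZero)
  open import Data.Nat.Properties
  open import Data.Nat.Divisibility using (_∣_; ∣-refl; _∣0; ∣n∣m%n⇒∣m; %-presˡ-∣)
  open import Data.Nat.DivMod
  open import Data.Nat.Coprimality as Coprimality using (Coprime; coprime?)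
  open import Data.Nat.GCD using (gcd; module Bézout)
  open import Data.Nat.Tactic.RingSolver using (solve-∀)
  open import Data.Fin using (Fin; toℕ; fromℕ<)
  import Data.Fin.Properties as Fin
  open import Data.Fin.Permutation using (Permutation; permutation)
  open import Algebra.Properties.Semiring.Sum +-*-semiring
    using (sum; sum-cong-≗; sum-permute; ∑-comm; *-distribˡ-sum; *-distribʳ-sum; sum-init-last)
  open import Data.List using (filter; length; applyUpTo)
  import Data.List.Properties as List
  open import Data.Product using (∃; _,_; proj₁; proj₂)
  open import Data.Empty using (⊥-elim)
  open import Relation.Nullary using (Dec; yes; no)
  open import Relation.Binary.PropositionalEquality
  open ≡-Reasoning

  Σ< : ℕ → (ℕ → ℕ) → ℕ
  Σ< N g = sum {N} (λ i → g (toℕ i))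

  Σ<-cong : ∀ N {g h} → (∀ x → g x ≡ h x) → Σ< N g ≡ Σ< N h
  Σ<-cong N g≗h = sum-cong-≗ {N} (λ i → g≗h (toℕ i))

  Σ<-+ : ∀ a b g → Σ< (a + b) g ≡ Σ< a g + Σ< b (λ x → g (a + x))
  Σ<-+ zero    b g = refl
  Σ<-+ (suc a) b g = trans (cong (g 0 +_) (Σ<-+ a b (λ x → g (suc x)))) (sym (+-assoc (g 0) _ _))

  Σ<-blocks : ∀ a b g → Σ< (a * b) g ≡ Σ< a (λ j → Σ< b (λ i → g (j * b + i)))
  Σ<-blocks zero    b g = refl
  Σ<-blocks (suc a) b g = begin
    Σ< (b + a * b) g                                           ≡⟨ Σ<-+ b (a * b) g ⟩
    Σ< b g + Σ< (a * b) (λ x → g (b + x))                      ≡⟨ cong (Σ< b g +_) (Σ<-blocks a b (λ x → g (b + x))) ⟩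
    Σ< b g + Σ< a (λ j → Σ< b (λ i → g (b + (j * b + i))))     ≡⟨ cong (Σ< b g +_) (Σ<-cong a λ j →
                                                                     Σ<-cong b λ i → cong g (sym (+-assoc b (j * b) i))) ⟩
    Σ< b g + Σ< a (λ j → Σ< b (λ i → g (b + j * b + i)))       ∎

  Σ<-last : ∀ n g → Σ< (suc n) g ≡ Σ< n g + g n
  Σ<-last n g = trans (sum-init-last {n} (λ i → g (toℕ i)))
    (cong₂ _+_ (sum-cong-≗ {n} (λ i → cong g (Fin.toℕ-inject₁ i))) (cong g (Fin.toℕ-fromℕ n)))

  Σ<-rotate : ∀ n g → g n ≡ g 0 → Σ< n (λ x → g (suc x)) ≡ Σ< n g
  Σ<-rotate n g gn≡g0 = +-cancelʳ-≡ (g 0) _ _ (begin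
    Σ< n (λ x → g (suc x)) + g 0 ≡⟨ +-comm _ (g 0) ⟩
    Σ< (suc n) g                 ≡⟨ Σ<-last n g ⟩
    Σ< n g + g n                 ≡⟨ cong (Σ< n g +_) gn≡g0 ⟩
    Σ< n g + g 0                 ∎)

  RespectsMod : (m : ℕ) .{{_ : NonZero m}} → (ℕ → ℕ) → Set
  RespectsMod m g = ∀ x y → x % m ≡ y % m → g x ≡ g y

  respectsMod-translate : ∀ m .{{_ : NonZero m}} {g} i → RespectsMod m g → RespectsMod m (λ y → g (y + i))
  respectsMod-translate m i resp x y x≡y = resp (x + i) (y + i) (begin
    (x + i) % m             ≡⟨ %-distribˡ-+ x i m ⟩
    (x % m + i % m) % m     ≡⟨ cong (λ r → (r + i % m) % m) x≡y ⟩
    (y % m + i % m) % m     ≡⟨ %-distribˡ-+ y i m ⟨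
    (y + i) % m             ∎)

  Σ<-translate : ∀ m .{{_ : NonZero m}} g i → RespectsMod m g → Σ< m (λ j → g (j + i)) ≡ Σ< m g
  Σ<-translate m g zero    resp = Σ<-cong m (λ j → cong g (+-identityʳ j))
  Σ<-translate m g (suc i) resp = begin
    Σ< m (λ j → g (j + suc i))   ≡⟨ Σ<-cong m (λ j → cong g (+-suc j i)) ⟩
    Σ< m (λ j → g (suc j + i))   ≡⟨ Σ<-rotate m (λ y → g (y + i)) (resp (m + i) (0 + i) period) ⟩
    Σ< m (λ j → g (j + i))       ≡⟨ Σ<-translate m g i resp ⟩
    Σ< m g                       ∎
    where
    period : (m + i) % m ≡ (0 + i) % m
    period = trans (cong (_% m) (+-comm m i)) ([m+n]%n≡m%n i m)

  %-absorbˡ-* : ∀ a b m .{{_ : NonZero m}} → (a % m * b) % m ≡ (a * b) % m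
  %-absorbˡ-* a b m = begin
    (a % m * b) % m                 ≡⟨ %-distribˡ-* (a % m) b m ⟩
    ((a % m % m) * (b % m)) % m     ≡⟨ cong (λ r → (r * (b % m)) % m) (m%n%n≡m%n a m) ⟩
    ((a % m) * (b % m)) % m         ≡⟨ %-distribˡ-* a b m ⟨
    (a * b) % m                     ∎

  %-inverse : ∀ m .{{_ : NonZero m}} a b → (a * b) % m ≡ 1 % m → ∀ j → j < m → ((j * a) % m * b) % m ≡ j
  %-inverse m a b ab≡1 j j<m = begin
    ((j * a) % m * b) % m      ≡⟨ %-absorbˡ-* (j * a) b m ⟩
    (j * a * b) % m            ≡⟨ cong (_% m) (*-assoc j a b) ⟩
    (j * (a * b)) % m          ≡⟨ cong (_% m) (*-comm j (a * b)) ⟩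
    ((a * b) * j) % m          ≡⟨ %-absorbˡ-* (a * b) j m ⟨
    ((a * b) % m * j) % m      ≡⟨ cong (λ r → (r * j) % m) ab≡1 ⟩
    (1 % m * j) % m            ≡⟨ %-absorbˡ-* 1 j m ⟩
    (1 * j) % m                ≡⟨ cong (_% m) (*-identityˡ j) ⟩
    j % m                      ≡⟨ m<n⇒m%n≡m j<m ⟩
    j                          ∎

  %-inverse-exists : ∀ m .{{_ : NonZero m}} n → Coprime n m → ∃ λ n' → (n * n') % m ≡ 1 % m
  %-inverse-exists m@(suc m-1) n n⊥m with Coprimality.coprime-Bézout n⊥m
  ... | Bézout.+- x y 1+ym≡xn = x , (begin
    (n * x) % m          ≡⟨ cong (_% m) (trans (*-comm n x) (sym 1+ym≡xn)) ⟩
    (1 + y * m) % m      ≡⟨ [m+kn]%n≡m%n 1 y m ⟩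
    1 % m                ∎)
  ... | Bézout.-+ x y 1+xn≡ym = m-1 * x , (begin
    (n * (m-1 * x)) % m                 ≡⟨ [m+n]%n≡m%n (n * (m-1 * x)) m ⟨
    (n * (m-1 * x) + m) % m             ≡⟨ cong (_% m) (ring n m-1 x) ⟩
    (1 + m-1 * (1 + x * n)) % m         ≡⟨ cong (λ t → (1 + m-1 * t) % m) 1+xn≡ym ⟩
    (1 + m-1 * (y * m)) % m             ≡⟨ cong (λ t → (1 + t) % m) (sym (*-assoc m-1 y m)) ⟩
    (1 + m-1 * y * m) % m               ≡⟨ [m+kn]%n≡m%n 1 (m-1 * y) m ⟩
    1 % m                               ∎)
    where
    ring : ∀ n m-1 x → n * (m-1 * x) + suc m-1 ≡ 1 + m-1 * (1 + x * n)
    ring = solve-∀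

  -- For n coprime to m, j ↦ j·n mod m permutes [0, m); hence dilation leaves a full-period sum unchanged.
  Σ<-dilate : ∀ m .{{_ : NonZero m}} n → Coprime n m → ∀ g → RespectsMod m g →
              Σ< m (λ j → g (j * n)) ≡ Σ< m g
  Σ<-dilate m n n⊥m g resp = begin
    Σ< m (λ j → g (j * n))                ≡⟨ sum-cong-≗ {m} (λ i → resp _ _ (same-residue i)) ⟩
    sum {m} (λ i → g (toℕ (to i)))         ≡⟨ sum-permute {m} (λ i → g (toℕ i)) π ⟨
    Σ< m g                                 ∎
    where
    n' : ℕ
    n' = proj₁ (%-inverse-exists m n n⊥m)
    nn'≡1 : (n * n') % m ≡ 1 % m
    nn'≡1 = proj₂ (%-inverse-exists m n n⊥m)
    times : ℕ → Fin m → Fin m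
    times a i = fromℕ< (m%n<n (toℕ i * a) m)
    to : Fin m → Fin m
    to = times n
    toℕ-times : ∀ a i → toℕ (times a i) ≡ toℕ i * a % m
    toℕ-times a i = Fin.toℕ-fromℕ< (m%n<n (toℕ i * a) m)
    same-residue : ∀ i → (toℕ i * n) % m ≡ toℕ (to i) % m
    same-residue i = sym (trans (cong (_% m) (toℕ-times n i)) (m%n%n≡m%n (toℕ i * n) m))
    cancel : ∀ a b → (a * b) % m ≡ 1 % m → ∀ i → times b (times a i) ≡ i
    cancel a b ab≡1 i = Fin.toℕ-injective (begin
      toℕ (times b (times a i))    ≡⟨ toℕ-times b (times a i) ⟩
      toℕ (times a i) * b % m      ≡⟨ cong (λ r → r * b % m) (toℕ-times a i) ⟩
      (toℕ i * a % m) * b % m      ≡⟨ %-inverse m a b ab≡1 (toℕ i) (Fin.toℕ<n i) ⟩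
      toℕ i                        ∎)
    π : Permutation m m
    π = permutation to (times n')
      (cancel n' n (trans (cong (_% m) (*-comm n' n)) nn'≡1))
      (cancel n n' nn'≡1)

  𝟙 : ∀ {A : Set} → Dec A → ℕ
  𝟙 (yes _) = 1
  𝟙 (no _)  = 0

  𝟙-cong : ∀ {A B : Set} → (A → B) → (B → A) → (a : Dec A) (b : Dec B) → 𝟙 a ≡ 𝟙 b
  𝟙-cong A→B B→A (yes a) (yes b) = refl
  𝟙-cong A→B B→A (yes a) (no ¬b) = ⊥-elim (¬b (A→B a))
  𝟙-cong A→B B→A (no ¬a) (yes b) = ⊥-elim (¬a (B→A b))
  𝟙-cong A→B B→A (no ¬a) (no ¬b) = refl

  χ : ℕ → ℕ → ℕ
  χ N x = 𝟙 (coprime? x N)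

  χ-transfer : ∀ N x y → (∀ {c} → c ∣ N → c ∣ x → c ∣ y) → (∀ {c} → c ∣ N → c ∣ y → c ∣ x) → χ N x ≡ χ N y
  χ-transfer N x y x⇒y y⇒x = 𝟙-cong
    (λ x⊥N {c} (c∣y , c∣N) → x⊥N (y⇒x c∣N c∣y , c∣N))
    (λ y⊥N {c} (c∣x , c∣N) → y⊥N (x⇒y c∣N c∣x , c∣N))
    (coprime? x N) (coprime? y N)

  χ-respectsMod : ∀ N .{{_ : NonZero N}} → RespectsMod N (χ N)
  χ-respectsMod N x y x≡y = χ-transfer N x y
    (λ {c} c∣N c∣x → ∣n∣m%n⇒∣m c∣N (subst (c ∣_) x≡y (%-presˡ-∣ c∣x c∣N)))
    (λ {c} c∣N c∣y → ∣n∣m%n⇒∣m c∣N (subst (c ∣_) (sym x≡y) (%-presˡ-∣ c∣y c∣N)))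

  χ-* : ∀ m n x → χ (m * n) x ≡ χ m x * χ n x
  χ-* m n x with coprime? x (m * n) | coprime? x m | coprime? x n
  ... | yes _    | yes _  | yes _  = refl
  ... | yes x⊥mn | no x̸⊥m | _      = ⊥-elim (x̸⊥m (proj₁ (coprime-*⁻ {x} {m} {n} x⊥mn)))
  ... | yes x⊥mn | yes _  | no x̸⊥n = ⊥-elim (x̸⊥n (proj₂ (coprime-*⁻ {x} {m} {n} x⊥mn)))
  ... | no x̸⊥mn  | yes x⊥m | yes x⊥n = ⊥-elim (x̸⊥mn (coprime-* x⊥m x⊥n))
  ... | no _     | no _   | _      = refl
  ... | no _     | yes _  | no _   = refl

  length-filter-applyUpTo : ∀ {P : ℕ → Set} (P? : ∀ x → Dec (P x)) n h →
    length (filter P? (applyUpTo h n)) ≡ Σ< n (λ x → 𝟙 (P? (h x)))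
  length-filter-applyUpTo P? zero    h = refl
  length-filter-applyUpTo P? (suc n) h with P? (h 0)
  ... | yes _ = cong suc (length-filter-applyUpTo P? n (λ x → h (suc x)))
  ... | no _  = length-filter-applyUpTo P? n (λ x → h (suc x))

  -- φ n counts 1 ≤ x ≤ n; since χ n n = χ n 0 this equals the count over 0 ≤ x < n.
  φ≡Σχ : ∀ n → φ n ≡ Σ< n (χ n)
  φ≡Σχ n = begin
    φ n                                          ≡⟨ cong (λ l → length (filter (λ x → gcd x n ≟ 1) l)) (List.map-upTo suc n) ⟩
    length (filter (λ x → gcd x n ≟ 1) (applyUpTo suc n))
                                                 ≡⟨ length-filter-applyUpTo (λ x → gcd x n ≟ 1) n suc ⟩
    Σ< n (λ x → 𝟙 (gcd (suc x) n ≟ 1))           ≡⟨ Σ<-cong n (λ x → 𝟙-cong Coprimality.gcd≡1⇒coprime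
                                                      Coprimality.coprime⇒gcd≡1 (gcd (suc x) n ≟ 1) (coprime? (suc x) n)) ⟩
    Σ< n (λ x → χ n (suc x))                     ≡⟨ Σ<-rotate n (χ n) (χ-transfer n n 0 (λ _ _ → _ ∣0) (λ c∣n _ → c∣n)) ⟩
    Σ< n (χ n)                                   ∎

  -- Over [0, mn) written as j·n + i, χ_{mn}(jn+i) = χ_m(jn+i)·χ_n(i);
  -- for fixed i, summing χ_m(jn+i) over j < m gives φ(m) by dilation and translation invariance.
  -- (If m or n is 0 both sides vanish, or coprimality forces the other factor to be 1.)
  φ-* : ∀ m n → Coprime m n → φ (m * n) ≡ φ m * φ n
  φ-* zero    n       m⊥n = refl
  φ-* (suc m) zero    m⊥n with m⊥n (∣-refl , suc m ∣0)
  ... | refl = refl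
  φ-* m@(suc _) n@(suc _) m⊥n = begin
    φ (m * n)                                                ≡⟨ φ≡Σχ (m * n) ⟩
    Σ< (m * n) (χ (m * n))                                   ≡⟨ Σ<-blocks m n (χ (m * n)) ⟩
    Σ< m (λ j → Σ< n (λ i → χ (m * n) (j * n + i)))          ≡⟨ Σ<-cong m (λ j → Σ<-cong n (λ i → split j i)) ⟩
    Σ< m (λ j → Σ< n (λ i → χ m (j * n + i) * χ n i))        ≡⟨ ∑-comm {m} {n} (λ j i → χ m (toℕ j * n + toℕ i) * χ n (toℕ i)) ⟩
    Σ< n (λ i → Σ< m (λ j → χ m (j * n + i) * χ n i))        ≡⟨ Σ<-cong n (λ i → *-distribʳ-sum {m} (χ n i) (λ j → χ m (toℕ j * n + i))) ⟨
    Σ< n (λ i → Σ< m (λ j → χ m (j * n + i)) * χ n i)        ≡⟨ Σ<-cong n (λ i → cong (_* χ n i) (inner i)) ⟩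
    Σ< n (λ i → Σ< m (χ m) * χ n i)                          ≡⟨ *-distribˡ-sum {n} (Σ< m (χ m)) (λ i → χ n (toℕ i)) ⟨
    Σ< m (χ m) * Σ< n (χ n)                                  ≡⟨ cong₂ _*_ (φ≡Σχ m) (φ≡Σχ n) ⟨
    φ m * φ n                                                ∎
    where
    split : ∀ j i → χ (m * n) (j * n + i) ≡ χ m (j * n + i) * χ n i
    split j i = trans (χ-* m n (j * n + i))
      (cong (χ m (j * n + i) *_) (χ-respectsMod n _ i (trans (cong (_% n) (+-comm (j * n) i)) ([m+kn]%n≡m%n i j n))))
    inner : ∀ i → Σ< m (λ j → χ m (j * n + i)) ≡ Σ< m (χ m)
    inner i = trans (Σ<-dilate m n (Coprimality.sym m⊥n) (λ y → χ m (y + i)) (respectsMod-translate m i (χ-respectsMod m)))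
                    (Σ<-translate m (χ m) i (χ-respectsMod m))

module ScaledGcd where

  open import Data.Nat using (ℕ; zero; suc; _*_; NonZero)
  open import Data.Nat.Properties using (*-assoc; *-comm)
  open import Data.Nat.Divisibility using (_∣_; _∣0; ∣n⇒∣m*n; *-monoˡ-∣; *-cancelʳ-∣)
  open import Data.Nat.Coprimality as Coprimality using (coprime-divisor)
  open import Data.Nat.GCD using (gcd; gcd[m,n]∣m; gcd[m,n]∣n; gcd[m,n]≡0⇒m≡0; gcd[m,n]≡0⇒n≡0)
  open import Data.Nat.DivMod using (_/_; m/n*n≡m)
  open import Relation.Binary.PropositionalEquality using (_≡_; sym; trans; cong; subst; subst₂)

  -- If G divides c·xₙ for every n, then G divides c·X where X is a greatest common divisor of the xₙ:
  -- with g = gcd(G, c), G/g is coprime to c/g, so G/g divides every xₙ and hence X.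
  divides-scaled-gcd : ∀ G c (x : ℕ → ℕ) X → (∀ n → G ∣ c * x n) → (∀ e → (∀ n → e ∣ x n) → e ∣ X) → G ∣ c * X
  divides-scaled-gcd G c x X G∣cx X-greatest with gcd G c in g≡
  ... | zero  = subst₂ (λ a b → a ∣ b * X) (sym (gcd[m,n]≡0⇒m≡0 g≡)) (sym (gcd[m,n]≡0⇒n≡0 G g≡)) (0 ∣0)
  ... | suc _ = subst₂ _∣_ G≡ug (sym (c≡vg X)) (*-monoˡ-∣ (gcd G c) (∣n⇒∣m*n v (X-greatest u u∣x)))
    where
    instance
      g≢0 : NonZero (gcd G c)
      g≢0 = subst NonZero (sym g≡) _
    u = G / gcd G c
    v = c / gcd G c
    G≡ug : u * gcd G c ≡ G
    G≡ug = m/n*n≡m (gcd[m,n]∣m G c)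
    c≡vg : ∀ y → c * y ≡ v * y * gcd G c
    c≡vg y = trans (cong (_* y) (sym (m/n*n≡m (gcd[m,n]∣n G c))))
      (trans (*-assoc v _ y) (trans (cong (v *_) (*-comm (gcd G c) y)) (sym (*-assoc v y _))))
    u∣x : ∀ n → u ∣ x n
    u∣x n = coprime-divisor (Coprimality.coprime-/gcd G c)
      (*-cancelʳ-∣ (gcd G c) (subst₂ _∣_ (sym G≡ug) (c≡vg (x n)) (G∣cx n)))

open import Data.Nat using (ℕ; _*_; _!)
open import Data.Nat.Divisibility using (_∣_)
open import Data.Nat.GCD using (gcd)
open import Data.Integer as ℤ using (ℤ; +_; ∣_∣)
open import Data.Product using (∃; _×_)
open import Relation.Binary.PropositionalEquality using (_≡_)

open import Data.Nat as ℕ using (suc)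
import Data.Nat.Properties as ℕP
import Data.Integer.Properties as ℤP
open import Data.Nat.Coprimality using (Coprime; coprime⇒gcd≡1)
open import Data.Product using (_,_; proj₁; proj₂)
open import Relation.Binary.PropositionalEquality using (cong; subst; module ≡-Reasoning)
open FixedDivisor using (fixedDivisor∣factorial)
open NumberTheory using (primorial≢0; ∣!-coprime; divisor-nonZero)
open Totient using (φ-*)
open ScaledGcd using (divides-scaled-gcd)

-- Part (iii): if d·F(n) = f(a + n·M) with every F(n) coprime to d, then 𝒢(f) ∣ φ(d)·𝒢(F), because
-- 𝒢(f) divides each φ(f(a + n·M)) = φ(d)·φ(F(n)) with a + n·M ≥ 1.
𝒢-divides : ∀ f F d a M .{{_ : ℕ.NonZero M}} →
  (∀ n → + d ℤ.* eval F n ≡ eval f (+ a ℤ.+ n ℤ.* + M)) → (∀ n → Coprime d ∣ eval F n ∣) →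
  ∀ Gf GF → Is𝒢 f Gf → Is𝒢 F GF → Gf ∣ φ d * GF
𝒢-divides f F d a M d*F d⊥F Gf GF (Gf∣φf , _) (_ , GF-greatest) =
  divides-scaled-gcd Gf (φ d) (λ n → φ (∣ eval F (+ suc n) ∣)) GF Gf∣φdφF GF-greatest
  where
  Gf∣φdφF : ∀ n → Gf ∣ φ d * φ (∣ eval F (+ suc n) ∣)
  Gf∣φdφF n = subst (Gf ∣_) φ-factors (Gf∣φf (ℕ.pred N))
    where
    N : ℕ
    N = a ℕ.+ suc n * M
    instance
      N≢0 : ℕ.NonZero N
      N≢0 = ℕ.>-nonZero (ℕP.<-≤-trans (ℕ.>-nonZero⁻¹ (suc n * M) {{ℕP.m*n≢0 (suc n) M}}) (ℕP.m≤n+m (suc n * M) a))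
    φ-factors : φ (∣ eval f (+ suc (ℕ.pred N)) ∣) ≡ φ d * φ (∣ eval F (+ suc n) ∣)
    φ-factors = begin
      φ (∣ eval f (+ suc (ℕ.pred N)) ∣)        ≡⟨ cong (λ m → φ (∣ eval f (+ m) ∣)) (ℕP.suc-pred N) ⟩
      φ (∣ eval f (+ N) ∣)                     ≡⟨ cong (λ x → φ (∣ eval f x ∣)) (ℤP.pos-+ a (suc n * M)) ⟩
      φ (∣ eval f (+ a ℤ.+ + (suc n * M)) ∣)   ≡⟨ cong (λ x → φ (∣ eval f (+ a ℤ.+ x) ∣)) (ℤP.pos-* (suc n) M) ⟩
      φ (∣ eval f (+ a ℤ.+ + suc n ℤ.* + M) ∣) ≡⟨ cong (λ x → φ (∣ x ∣)) (d*F (+ suc n)) ⟨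
      φ (∣ + d ℤ.* eval F (+ suc n) ∣)         ≡⟨ cong φ (ℤP.abs-* (+ d) (eval F (+ suc n))) ⟩
      φ (d * ∣ eval F (+ suc n) ∣)             ≡⟨ φ-* d ∣ eval F (+ suc n) ∣ (d⊥F (+ suc n)) ⟩
      φ d * φ (∣ eval F (+ suc n) ∣)           ∎
      where open ≡-Reasoning

lemma1 : (f : Poly) (k : ℕ) → Primitive f → HasDegree f k →
    (d : ℕ) → IsGcdOf (λ n → ∣ eval f (+ n) ∣) d →
    (d ∣ k !) ×
    (∃ λ (a : ℤ) → ∃ λ (F : Poly) →
      (∀ (n : ℤ) → (+ d) ℤ.* eval F n ≡ eval f (a ℤ.+ n ℤ.* (+ (d * primorial k)))) ×
      (∀ (n : ℤ) → gcd ∣ eval F n ∣ (primorial k) ≡ 1) ×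
      (∀ (Gf GF : ℕ) → Is𝒢 f Gf → Is𝒢 F GF → Gf ∣ φ d * GF))
lemma1 f k prim hasDeg d d-gcd =
  d∣k! , + a , F , d*F , (λ n → coprime⇒gcd≡1 (F⊥P n)) , 𝒢-divides f F d a (d * P) d*F d⊥F
  where
  P : ℕ
  P = primorial k
  d∣k! : d ∣ k !
  d∣k! = fixedDivisor∣factorial f k prim hasDeg d d-gcd
  instance
    d≢0 : ℕ.NonZero d
    d≢0 = divisor-nonZero {{k ℕP.!≢0}} d∣k!
    dP≢0 : ℕ.NonZero (d * P)
    dP≢0 = ℕP.m*n≢0 d P {{d≢0}} {{primorial≢0 k}}
  open Construction f d d-gcd
  a : ℕ
  a = proj₁ (good-exists k)
  F : Poly
  F = reduced P (+ a)
  d*F : ∀ n → + d ℤ.* eval F n ≡ eval f (+ a ℤ.+ n ℤ.* + (d * P))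
  d*F = d*reduced P (+ a)
  F⊥P : ∀ n → Coprime ∣ eval F n ∣ P
  F⊥P = reduced-coprime k (+ a) (proj₂ (good-exists k))
  d⊥F : ∀ n → Coprime d ∣ eval F n ∣
  d⊥F n = ∣!-coprime k d∣k! (F⊥P n)
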